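{- Let $B$ be an $(m+1)\times(m+1)$ alternating sign matrix. Let $A^{\min}$ be the $m\times m$ alternating sign matrix whose left corner sum matrix is $\bar A^{\min}_{i,j}=\max(\bar B_{i,j},\bar B_{i+1,j+1}-1)$, and let $A_{\max}$ be the $m\times m$ alternating sign matrix whose right corner sum matrix is $\underline A_{\max,i,j}=\min(\underline B_{i,j},\underline B_{i+1,j+1})$ ($1\le i,j\le m$). Then $A^{\min}=A_{\max}$.
   Context: An alternating sign matrix (ASM) is a square matrix with entries in $\{0,1,-1\}$ whose row and column sums are all $1$ and whose nonzero entries alternate in sign along every row and column. For an $r\times r$ ASM $X$, the left corner sum matrix is $\bar X_{i,j}=\sum_{i'\le i,j'\le j}X_{i',j'}$ and the right corner sum matrix is $\underline X_{i,j}=\sum_{i'\le i,j'\ge j}X_{i',j'}$; an ASM is determined by either. $A^{\min}$ is the entrywise-smallest ASM left interlacing with $B$ (i.e. satisfying $\max(\bar B_{i,j},\bar B_{i+1,j+1}-1)\le\bar A_{i,j}\le\min(\bar B_{i,j+1},\bar B_{i+1,j})$), and $A_{\max}$ is the entrywise-largest ASM right interlacing with $B$ (i.e. satisfying $\max(\underline B_{i,j+1},\underline B_{i+1,j}-1)\le\underline A_{i,j}\le\min(\underline B_{i,j},\underline B_{i+1,j+1})$). -}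

module Defs where

open import Data.Nat using (ℕ; zero; suc; _<_; _≤_; _<?_; _≤?_)
open import Data.Integer using (ℤ; +_; -_; _+_; _-_; _⊔_; _⊓_)
open import Data.Fin using (Fin; toℕ; inject₁) renaming (suc to fsuc; zero to fzero)
open import Data.Product using (_×_)
open import Data.Sum using (_⊎_)
open import Data.Empty using (⊥)
open import Relation.Binary.PropositionalEquality using (_≡_)
open import Relation.Nullary.Decidable using (Dec; yes; no)

Matrix : ℕ → Set
Matrix n = Fin n → Fin n → ℤ

sumFin : ∀ {n} → (Fin n → ℤ) → ℤ
sumFin {zero}  f = + 0
sumFin {suc n} f = f fzero + sumFin (λ k → f (fsuc k))

when : ∀ {p} {P : Set p} → Dec P → ℤ → ℤ
when (yes _) x = x
when (no _)  _ = + 0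

-- Left corner sum  bar X_{i,j} = Σ_{i' ≤ i, j' ≤ j} X_{i',j'}  with 1-based i, j
-- (row r, column c in 0-based Fin indexing correspond to 1-based r+1, c+1).
leftCorner : ∀ {n} → Matrix n → ℕ → ℕ → ℤ
leftCorner X i j =
  sumFin (λ r → sumFin (λ c → when (suc (toℕ r) ≤? i) (when (suc (toℕ c) ≤? j) (X r c))))

rightCorner : ∀ {n} → Matrix n → ℕ → ℕ → ℤ
rightCorner X i j =
  sumFin (λ r → sumFin (λ c → when (suc (toℕ r) ≤? i) (when (j ≤? suc (toℕ c)) (X r c))))

record IsASM {n : ℕ} (X : Matrix n) : Set where
  field
    entries  : ∀ r c → (X r c ≡ + 0) ⊎ (X r c ≡ + 1) ⊎ (X r c ≡ - (+ 1))
    rowSum   : ∀ r → sumFin (λ c → X r c) ≡ + 1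
    colSum   : ∀ c → sumFin (λ r → X r c) ≡ + 1
    rowAlt   : ∀ r (c₁ c₂ : Fin n) → toℕ c₁ < toℕ c₂ →
               (X r c₁ ≡ + 0 → ⊥) → (X r c₂ ≡ + 0 → ⊥) →
               (∀ (c : Fin n) → toℕ c₁ < toℕ c → toℕ c < toℕ c₂ → X r c ≡ + 0) →
               X r c₁ + X r c₂ ≡ + 0
    colAlt   : ∀ c (r₁ r₂ : Fin n) → toℕ r₁ < toℕ r₂ →
               (X r₁ c ≡ + 0 → ⊥) → (X r₂ c ≡ + 0 → ⊥) →
               (∀ (r : Fin n) → toℕ r₁ < toℕ r → toℕ r < toℕ r₂ → X r c ≡ + 0) →
               X r₁ c + X r₂ c ≡ + 0

-- Row sums of an ASM are 1, so on the first i rows the left corner sum up to column j and the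
-- right corner sum from column j + 1 add up to i. This complement turns the right corner sums of
-- A_max into left corner sums, and turns  min (B̲_{i,j+1}, B̲_{i+1,j+2})  into
-- i − max (B̄_{i,j}, B̄_{i+1,j+1} − 1). Hence A^min and A_max have the same left corner sum
-- matrix, and a matrix is recovered from its left corner sums by inclusion–exclusion.
module Submission where

open import Defs
open import Data.Nat using (ℕ; suc)
open import Data.Integer using (ℤ; +_; _-_; _⊔_; _⊓_)
open import Data.Fin using (Fin; toℕ)
open import Relation.Binary.PropositionalEquality using (_≡_)

open import Data.Nat using (zero; _≤_; _<_; _≤?_; z≤n; s≤s; s≤s⁻¹)
import Data.Nat.Properties as ℕ
open import Data.Integer using (_+_; -_)
import Data.Integer.Properties as ℤ
open import Algebra.Properties.AbelianGroup ℤ.+-0-abelianGroup using (∙-cancelˡ; x≈z//y)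
open import Data.Integer.Solver using (module +-*-Solver)
open import Data.Fin using (fromℕ<) renaming (zero to fzero; suc to fsuc)
import Data.Fin.Properties as Fin
open import Data.Empty using (⊥-elim)
open import Data.Sum using (inj₁; inj₂)
open import Relation.Nullary using (Dec; yes; no; ¬_)
open import Relation.Binary.PropositionalEquality
  using (refl; sym; trans; cong; cong₂; subst₂; module ≡-Reasoning)

private
  variable
    n : ℕ

when-yes : ∀ {p} {P : Set p} (d : Dec P) {x : ℤ} → P → when d x ≡ x
when-yes (yes _) _ = refl
when-yes (no ¬p) p = ⊥-elim (¬p p)

when-no : ∀ {p} {P : Set p} (d : Dec P) {x : ℤ} → ¬ P → when d x ≡ + 0
when-no (yes p) ¬p = ⊥-elim (¬p p)
when-no (no _)  _  = refl

when-cong : ∀ {p q} {P : Set p} {Q : Set q} (d : Dec P) (e : Dec Q) {x : ℤ} →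
            (P → Q) → (Q → P) → when d x ≡ when e x
when-cong (yes _) (yes _) _ _ = refl
when-cong (yes p) (no ¬q) f _ = ⊥-elim (¬q (f p))
when-cong (no ¬p) (yes q) _ g = ⊥-elim (¬p (g q))
when-cong (no _)  (no _)  _ _ = refl

when-0 : ∀ {p} {P : Set p} (d : Dec P) → when d (+ 0) ≡ + 0
when-0 (yes _) = refl
when-0 (no _)  = refl

when-+ : ∀ {p} {P : Set p} (d : Dec P) (x y : ℤ) → when d (x + y) ≡ when d x + when d y
when-+ (yes _) _ _ = refl
when-+ (no _)  _ _ = refl

sumFin-cong : {f g : Fin n → ℤ} → (∀ k → f k ≡ g k) → sumFin f ≡ sumFin g
sumFin-cong {zero}  _ = refl
sumFin-cong {suc n} h = cong₂ _+_ (h fzero) (sumFin-cong (λ k → h (fsuc k)))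

sumFin-zero : {f : Fin n → ℤ} → (∀ k → f k ≡ + 0) → sumFin f ≡ + 0
sumFin-zero {zero}  _ = refl
sumFin-zero {suc n} h = cong₂ _+_ (h fzero) (sumFin-zero (λ k → h (fsuc k)))

sumFin-+ : (f g : Fin n → ℤ) → sumFin (λ k → f k + g k) ≡ sumFin f + sumFin g
sumFin-+ {zero}  _ _ = refl
sumFin-+ {suc n} f g = trans
  (cong (_+_ (f fzero + g fzero)) (sumFin-+ (λ k → f (fsuc k)) (λ k → g (fsuc k))))
  (interchange (f fzero) (g fzero) (sumFin (λ k → f (fsuc k))) (sumFin (λ k → g (fsuc k))))
  where
  open +-*-Solver
  interchange : ∀ a b c d → (a + b) + (c + d) ≡ (a + c) + (b + d)
  interchange = solve 4 (λ a b c d → (a :+ b) :+ (c :+ d) := (a :+ c) :+ (b :+ d)) refl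

when-sumFin : ∀ {p} {P : Set p} (d : Dec P) (f : Fin n → ℤ) →
              when d (sumFin f) ≡ sumFin (λ k → when d (f k))
when-sumFin (yes _) _ = refl
when-sumFin {n} (no _) _ = sym (sumFin-zero {n} (λ _ → refl))

sumFin-δ : (f : Fin n → ℤ) (c : Fin n) → sumFin (λ k → when (k Fin.≟ c) (f k)) ≡ f c
sumFin-δ {suc n} f fzero = begin
  when (fzero {n} Fin.≟ fzero) (f fzero) + sumFin (λ k → when (fsuc k Fin.≟ fzero) (f (fsuc k)))
    ≡⟨ cong₂ _+_ (when-yes (fzero {n} Fin.≟ fzero) {f fzero} refl)
                 (sumFin-zero {n} (λ k → when-no (fsuc k Fin.≟ fzero) {f (fsuc k)} λ ())) ⟩
  f fzero + + 0
    ≡⟨ ℤ.+-identityʳ (f fzero) ⟩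
  f fzero ∎
  where open ≡-Reasoning
sumFin-δ {suc n} f (fsuc c) = begin
  when (fzero Fin.≟ fsuc c) (f fzero) + sumFin (λ k → when (fsuc k Fin.≟ fsuc c) (f (fsuc k)))
    ≡⟨ cong₂ _+_ (when-no (fzero Fin.≟ fsuc c) {f fzero} λ ())
                 (sumFin-cong λ k →
                    when-cong (fsuc k Fin.≟ fsuc c) (k Fin.≟ c) Fin.suc-injective (cong fsuc)) ⟩
  + 0 + sumFin (λ k → when (k Fin.≟ c) (f (fsuc k)))
    ≡⟨ ℤ.+-identityˡ _ ⟩
  sumFin (λ k → when (k Fin.≟ c) (f (fsuc k)))
    ≡⟨ sumFin-δ (λ k → f (fsuc k)) c ⟩
  f (fsuc c) ∎
  where open ≡-Reasoning

when-≤-suc : (k r : Fin n) (y : ℤ) →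
  when (suc (toℕ k) ≤? suc (toℕ r)) y ≡ when (suc (toℕ k) ≤? toℕ r) y + when (k Fin.≟ r) y
when-≤-suc k r y with k Fin.≟ r | suc (toℕ k) ≤? toℕ r
... | yes refl | yes k<k = ⊥-elim (ℕ.<-irrefl refl k<k)
... | yes refl | no _    =
  trans (when-yes (suc (toℕ k) ≤? suc (toℕ k)) ℕ.≤-refl) (sym (ℤ.+-identityˡ y))
... | no _     | yes k<r =
  trans (when-yes (suc (toℕ k) ≤? suc (toℕ r)) (ℕ.m≤n⇒m≤1+n k<r)) (sym (ℤ.+-identityʳ y))
... | no k≢r   | no k≮r  = when-no (suc (toℕ k) ≤? suc (toℕ r))
  λ k≤r → k≮r (ℕ.≤∧≢⇒< (s≤s⁻¹ k≤r) λ k≡r → k≢r (Fin.toℕ-injective k≡r))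

sumFin-below-suc : (f : Fin n → ℤ) (r : Fin n) →
  sumFin (λ k → when (suc (toℕ k) ≤? suc (toℕ r)) (f k))
    ≡ sumFin (λ k → when (suc (toℕ k) ≤? toℕ r) (f k)) + f r
sumFin-below-suc {n} f r = trans (sumFin-cong {n} λ k → when-≤-suc k r (f k))
  (trans (sumFin-+ {n} _ _)
         (cong (_+_ (sumFin (λ k → when (suc (toℕ k) ≤? toℕ r) (f k)))) (sumFin-δ f r)))

sumFin-below : ∀ {a} → a ≤ n → sumFin {n} (λ k → when (suc (toℕ k) ≤? a) (+ 1)) ≡ + a
sumFin-below {n} {zero} _ = sumFin-zero {n} λ k → when-no (suc (toℕ k) ≤? 0) {+ 1} λ ()
sumFin-below {suc n} {suc a} (s≤s a≤n) = cong₂ _+_ (when-yes (1 ≤? suc a) {+ 1} (s≤s z≤n))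
  (trans (sumFin-cong {n} λ k →
            when-cong (suc (suc (toℕ k)) ≤? suc a) (suc (toℕ k) ≤? a) s≤s⁻¹ s≤s)
         (sumFin-below a≤n))

rowPrefix : Matrix n → Fin n → ℕ → ℤ
rowPrefix X r j = sumFin (λ c → when (suc (toℕ c) ≤? j) (X r c))

leftCorner-byRows : (X : Matrix n) (i j : ℕ) →
  leftCorner X i j ≡ sumFin (λ r → when (suc (toℕ r) ≤? i) (rowPrefix X r j))
leftCorner-byRows X i j = sumFin-cong λ r →
  sym (when-sumFin (suc (toℕ r) ≤? i) λ c → when (suc (toℕ c) ≤? j) (X r c))

leftCorner-sucRow : (X : Matrix n) (r : Fin n) (j : ℕ) →
  leftCorner X (suc (toℕ r)) j ≡ leftCorner X (toℕ r) j + rowPrefix X r j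
leftCorner-sucRow X r j = trans (leftCorner-byRows X (suc (toℕ r)) j)
  (trans (sumFin-below-suc (λ k → rowPrefix X k j) r)
         (cong (_+ rowPrefix X r j) (sym (leftCorner-byRows X (toℕ r) j))))

rowPrefix-sucColumn : (X : Matrix n) (r c : Fin n) →
  rowPrefix X r (suc (toℕ c)) ≡ rowPrefix X r (toℕ c) + X r c
rowPrefix-sucColumn X r = sumFin-below-suc (X r)

leftCorner-zeroˡ : (X : Matrix n) (j : ℕ) → leftCorner X 0 j ≡ + 0
leftCorner-zeroˡ {n} X j = sumFin-zero {n} λ r → sumFin-zero {n} λ c →
  when-no (suc (toℕ r) ≤? 0) {when (suc (toℕ c) ≤? j) (X r c)} λ ()

leftCorner-zeroʳ : (X : Matrix n) (i : ℕ) → leftCorner X i 0 ≡ + 0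
leftCorner-zeroʳ {n} X i = trans (leftCorner-byRows X i 0) (sumFin-zero {n} λ r →
  trans (cong (when (suc (toℕ r) ≤? i)) (emptyPrefix r)) (when-0 (suc (toℕ r) ≤? i)))
  where
  emptyPrefix : ∀ r → rowPrefix X r 0 ≡ + 0
  emptyPrefix r = sumFin-zero {n} λ c → when-no (suc (toℕ c) ≤? 0) {X r c} λ ()

leftCorner-injective : (X Y : Matrix n) →
  (∀ {a b} → a ≤ n → b ≤ n → leftCorner X a b ≡ leftCorner Y a b) → ∀ r c → X r c ≡ Y r c
leftCorner-injective X Y eq r c = ∙-cancelˡ (rowPrefix X r (toℕ c)) _ _ (begin
  rowPrefix X r (toℕ c) + X r c    ≡⟨ sym (rowPrefix-sucColumn X r c) ⟩
  rowPrefix X r (suc (toℕ c))      ≡⟨ rowPrefix-eq (Fin.toℕ<n c) ⟩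
  rowPrefix Y r (suc (toℕ c))      ≡⟨ rowPrefix-sucColumn Y r c ⟩
  rowPrefix Y r (toℕ c) + Y r c    ≡⟨ cong (_+ Y r c) (rowPrefix-eq (ℕ.<⇒≤ (Fin.toℕ<n c))) ⟨
  rowPrefix X r (toℕ c) + Y r c    ∎)
  where
  open ≡-Reasoning
  rowPrefix-eq : ∀ {j} → j ≤ _ → rowPrefix X r j ≡ rowPrefix Y r j
  rowPrefix-eq {j} j≤n = ∙-cancelˡ (leftCorner X (toℕ r) j) _ _ (begin
    leftCorner X (toℕ r) j + rowPrefix X r j  ≡⟨ sym (leftCorner-sucRow X r j) ⟩
    leftCorner X (suc (toℕ r)) j              ≡⟨ eq (Fin.toℕ<n r) j≤n ⟩
    leftCorner Y (suc (toℕ r)) j              ≡⟨ leftCorner-sucRow Y r j ⟩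
    leftCorner Y (toℕ r) j + rowPrefix Y r j  ≡⟨ cong (_+ rowPrefix Y r j) (eq (ℕ.<⇒≤ (Fin.toℕ<n r)) j≤n) ⟨
    leftCorner X (toℕ r) j + rowPrefix Y r j  ∎)

RowSumsOne : Matrix n → Set
RowSumsOne X = ∀ r → sumFin (X r) ≡ + 1

when-≤?-complement : (b c : ℕ) (x : ℤ) → when (suc c ≤? b) x + when (suc b ≤? suc c) x ≡ x
when-≤?-complement b c x with suc c ≤? b | suc b ≤? suc c
... | yes c<b | yes b≤c = ⊥-elim (ℕ.<⇒≱ c<b (s≤s⁻¹ b≤c))
... | yes _   | no _    = ℤ.+-identityʳ x
... | no _    | yes _   = ℤ.+-identityˡ x
... | no c≮b  | no b≰c  = ⊥-elim (b≰c (s≤s (ℕ.≮⇒≥ c≮b)))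

leftCorner-+-rightCorner : (X : Matrix n) (i j : ℕ) →
  leftCorner X i j + rightCorner X i (suc j) ≡ leftCorner X i n
leftCorner-+-rightCorner {n} X i j = trans (sym (sumFin-+ {n} _ _)) (sumFin-cong λ r →
  trans (sym (sumFin-+ {n} _ _)) (sumFin-cong λ c → begin
    when (row r) (when (suc (toℕ c) ≤? j) (X r c))
      + when (row r) (when (suc j ≤? suc (toℕ c)) (X r c))
      ≡⟨ sym (when-+ (row r) _ _) ⟩
    when (row r) (when (suc (toℕ c) ≤? j) (X r c) + when (suc j ≤? suc (toℕ c)) (X r c))
      ≡⟨ cong (when (row r)) (when-≤?-complement j (toℕ c) (X r c)) ⟩
    when (row r) (X r c)
      ≡⟨ cong (when (row r)) (sym (when-yes (suc (toℕ c) ≤? n) (Fin.toℕ<n c))) ⟩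
    when (row r) (when (suc (toℕ c) ≤? n) (X r c)) ∎))
  where
  open ≡-Reasoning
  row : (r : Fin n) → Dec (suc (toℕ r) ≤ i)
  row r = suc (toℕ r) ≤? i

leftCorner-fullWidth : (X : Matrix n) → RowSumsOne X → ∀ {i} → i ≤ n → leftCorner X i n ≡ + i
leftCorner-fullWidth {n} X rows {i} i≤n = begin
  leftCorner X i n                                         ≡⟨ leftCorner-byRows X i n ⟩
  sumFin (λ r → when (suc (toℕ r) ≤? i) (rowPrefix X r n))
    ≡⟨ sumFin-cong (λ r → cong (when (suc (toℕ r) ≤? i)) (fullRow r)) ⟩
  sumFin {n} (λ r → when (suc (toℕ r) ≤? i) (+ 1))          ≡⟨ sumFin-below i≤n ⟩
  + i                                                       ∎
  where
  open ≡-Reasoning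
  fullRow : ∀ r → rowPrefix X r n ≡ + 1
  fullRow r = trans (sumFin-cong λ c → when-yes (suc (toℕ c) ≤? n) (Fin.toℕ<n c)) (rows r)

rightCorner-complement : (X : Matrix n) → RowSumsOne X → ∀ {i} → i ≤ n → ∀ j →
  rightCorner X i (suc j) ≡ + i - leftCorner X i j
rightCorner-complement X rows {i} i≤n j = x≈z//y _ _ _ (begin
  rightCorner X i (suc j) + leftCorner X i j  ≡⟨ ℤ.+-comm _ (leftCorner X i j) ⟩
  leftCorner X i j + rightCorner X i (suc j)  ≡⟨ leftCorner-+-rightCorner X i j ⟩
  leftCorner X i _                            ≡⟨ leftCorner-fullWidth X rows i≤n ⟩
  + i                                         ∎)
  where open ≡-Reasoning

minLeftCorner : Matrix n → ℕ → ℕ → ℤ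
minLeftCorner B i j = leftCorner B i j ⊔ (leftCorner B (suc i) (suc j) - + 1)

maxRightCorner : Matrix n → ℕ → ℕ → ℤ
maxRightCorner B i j = rightCorner B i j ⊓ rightCorner B (suc i) (suc j)

neg-⊔-pred : ∀ k x y → + k - (x ⊔ (y - + 1)) ≡ (+ k - x) ⊓ (+ suc k - y)
neg-⊔-pred k x y = begin
  + k + - (x ⊔ (y - + 1))          ≡⟨ cong (_+_ (+ k)) (ℤ.neg-distrib-⊔-⊓ x (y - + 1)) ⟩
  + k + (- x ⊓ - (y - + 1))        ≡⟨ ℤ.mono-≤-distrib-⊓ (ℤ.+-monoʳ-≤ (+ k)) (- x) (- (y - + 1)) ⟩
  (+ k - x) ⊓ (+ k - (y - + 1))    ≡⟨ cong ((+ k - x) ⊓_) (shift (+ k) y) ⟩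
  (+ k - x) ⊓ (+ suc k - y)        ∎
  where
  open ≡-Reasoning
  open +-*-Solver
  shift : ∀ k y → k - (y - + 1) ≡ + 1 + k - y
  shift = solve 2 (λ k y → k :- (y :- con (+ 1)) := con (+ 1) :+ k :- y) refl

maxRightCorner-complement : (B : Matrix n) → RowSumsOne B → ∀ {i} → suc i ≤ n → ∀ j →
  maxRightCorner B i (suc j) ≡ + i - minLeftCorner B i j
maxRightCorner-complement B rows {i} si≤n j = trans
  (cong₂ _⊓_ (rightCorner-complement B rows (ℕ.<⇒≤ si≤n) j)
             (rightCorner-complement B rows si≤n (suc j)))
  (sym (neg-⊔-pred i (leftCorner B i j) (leftCorner B (suc i) (suc j))))

∀Fin⇒∀< : ∀ {m} (P : ℕ → ℕ → Set) → (∀ (i j : Fin m) → P (toℕ i) (toℕ j)) →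
          ∀ {a b} → a < m → b < m → P a b
∀Fin⇒∀< P h a<m b<m =
  subst₂ P (Fin.toℕ-fromℕ< a<m) (Fin.toℕ-fromℕ< b<m) (h (fromℕ< a<m) (fromℕ< b<m))

-‿cancelˡ : ∀ k {x y} → k - x ≡ k - y → x ≡ y
-‿cancelˡ k eq = ℤ.neg-injective (∙-cancelˡ k _ _ eq)

corollary6p4p1 : (m : ℕ) (B : Matrix (suc m)) → IsASM B →
    (Amin Amax : Matrix m) → IsASM Amin → IsASM Amax →
    (∀ (i j : Fin m) → leftCorner Amin (suc (toℕ i)) (suc (toℕ j))
        ≡ (leftCorner B (suc (toℕ i)) (suc (toℕ j)) ⊔ (leftCorner B (suc (suc (toℕ i))) (suc (suc (toℕ j))) - + 1))) →
    (∀ (i j : Fin m) → rightCorner Amax (suc (toℕ i)) (suc (toℕ j))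
        ≡ (rightCorner B (suc (toℕ i)) (suc (toℕ j)) ⊓ rightCorner B (suc (suc (toℕ i))) (suc (suc (toℕ j))))) →
    ∀ (i j : Fin m) → Amin i j ≡ Amax i j
corollary6p4p1 m B asmB Amin Amax asmMin asmMax hmin hmax = leftCorner-injective Amin Amax corners
  where
  open ≡-Reasoning
  minAt : ∀ {a b} → a < m → b < m →
          leftCorner Amin (suc a) (suc b) ≡ minLeftCorner B (suc a) (suc b)
  minAt = ∀Fin⇒∀< (λ a b → leftCorner Amin (suc a) (suc b) ≡ minLeftCorner B (suc a) (suc b)) hmin

  maxAt : ∀ {a b} → a < m → b < m →
          rightCorner Amax (suc a) (suc b) ≡ maxRightCorner B (suc a) (suc b)
  maxAt = ∀Fin⇒∀< (λ a b → rightCorner Amax (suc a) (suc b) ≡ maxRightCorner B (suc a) (suc b)) hmax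

  interior : ∀ {a b} → a < m → suc b < m →
             leftCorner Amin (suc a) (suc b) ≡ leftCorner Amax (suc a) (suc b)
  interior {a} {b} a<m sb<m = -‿cancelˡ (+ suc a) (begin
    + suc a - leftCorner Amin (suc a) (suc b)
      ≡⟨ cong (λ x → + suc a - x) (minAt a<m (ℕ.<⇒≤ sb<m)) ⟩
    + suc a - minLeftCorner B (suc a) (suc b)
      ≡⟨ maxRightCorner-complement B (IsASM.rowSum asmB) (s≤s a<m) (suc b) ⟨
    maxRightCorner B (suc a) (suc (suc b))
      ≡⟨ maxAt a<m sb<m ⟨
    rightCorner Amax (suc a) (suc (suc b))
      ≡⟨ rightCorner-complement Amax (IsASM.rowSum asmMax) a<m (suc b) ⟩
    + suc a - leftCorner Amax (suc a) (suc b) ∎)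

  corners : ∀ {a b} → a ≤ m → b ≤ m → leftCorner Amin a b ≡ leftCorner Amax a b
  corners {zero}  {b}     _ _ = trans (leftCorner-zeroˡ Amin b) (sym (leftCorner-zeroˡ Amax b))
  corners {suc a} {zero}  _ _ = trans (leftCorner-zeroʳ Amin (suc a)) (sym (leftCorner-zeroʳ Amax (suc a)))
  corners {suc a} {suc b} a<m sb≤m with ℕ.m≤n⇒m<n∨m≡n sb≤m
  ... | inj₁ sb<m = interior a<m sb<m
  ... | inj₂ sb≡m rewrite sb≡m = trans (leftCorner-fullWidth Amin (IsASM.rowSum asmMin) a<m)
                                       (sym (leftCorner-fullWidth Amax (IsASM.rowSum asmMax) a<m))
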